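{- For every finite digraph $G$, $\mathsf{cr}(G)=\mathrm{wcol}^{\rightarrow}_{\infty}(G)-1$.
   Context: Cycle rank $\mathsf{cr}(G)$: $0$ if $G$ is acyclic; $1+\min_{v\in V(G)}\mathsf{cr}(G-v)$ if $G$ is strongly connected with at least one edge; otherwise the maximum cycle rank over the strongly connected components of $G$. Weak $(\infty,\rightarrow)$-coloring number: for a linear ordering $L$ of $V(G)$ with induced order $\le_L$, and a vertex $v$, let $\mathrm{WReach}^{\rightarrow}_{\infty}[G,L,v]$ be the set of vertices $w$ with $w\le_L v$ such that there is a directed path $P$ from $v$ to $w$ in $G$ (of any length, including length $0$) with $w\le_L u$ for every vertex $u$ of $P$. Then $\mathrm{wcol}^{\rightarrow}_{\infty}(G)=\min_L\max_{v\in V(G)}|\mathrm{WReach}^{\rightarrow}_{\infty}[G,L,v]|$, the minimum over all linear orderings $L$ of $V(G)$. -}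

module Defs where

open import Data.Nat using (ℕ; zero; suc; _⊔_; _⊓_; _≤_; _≤ᵇ_)
open import Data.Bool using (Bool; true; false; _∧_; _∨_; not; if_then_else_)
open import Data.Fin using (Fin; toℕ; _≟_)
open import Data.Fin.Permutation using (Permutation′; _⟨$⟩ʳ_)
open import Data.List using (List; []; _∷_; map; filter; foldr; length)
open import Data.Bool.ListAction using (any; all)
open import Data.List using (allFin)
open import Data.Product using (Σ; _×_)
open import Relation.Nullary.Decidable using (⌊_⌋)
open import Relation.Binary.PropositionalEquality using (_≡_)

record Digraph (n : ℕ) : Set where
  field
    E : Fin n → Fin n → Bool
open Digraph public

Loopless : ∀ {n} → Digraph n → Set
Loopless {n} G = (v : Fin n) → E G v v ≡ false

VSet : ℕ → Set
VSet n = Fin n → Bool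

elems : ∀ {n} → VSet n → List (Fin n)
elems {n} S = filter (λ v → S v Data.Bool.≟ true) (allFin n)

reachK : ∀ {n} → Digraph n → VSet n → ℕ → Fin n → Fin n → Bool
reachK G S zero    u v = S u ∧ ⌊ u ≟ v ⌋
reachK {n} G S (suc k) u v =
  reachK G S k u v ∨ any (λ w → reachK G S k u w ∧ E G w v ∧ S v) (allFin n)

-- Directed path (of any length, including 0) from u to v inside G[S].
-- (A path in an n-vertex graph has length < n.)
reach : ∀ {n} → Digraph n → VSet n → Fin n → Fin n → Bool
reach {n} G S = reachK G S n

-- G[S] has a directed cycle iff some arc u → v of G[S] has v reaching u in G[S].
hasCycle : ∀ {n} → Digraph n → VSet n → Bool
hasCycle G S =
  any (λ u → any (λ v → E G u v ∧ reach G S v u) (elems S)) (elems S)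

acyclic : ∀ {n} → Digraph n → VSet n → Bool
acyclic G S = not (hasCycle G S)

hasEdge : ∀ {n} → Digraph n → VSet n → Bool
hasEdge G S = any (λ u → any (λ v → E G u v) (elems S)) (elems S)

stronglyConnected : ∀ {n} → Digraph n → VSet n → Bool
stronglyConnected G S = all (λ u → all (λ v → reach G S u v) (elems S)) (elems S)

scc : ∀ {n} → Digraph n → VSet n → Fin n → VSet n
scc G S v u = S u ∧ reach G S v u ∧ reach G S u v

remove : ∀ {n} → VSet n → Fin n → VSet n
remove S v u = S u ∧ not ⌊ u ≟ v ⌋

maxL : List ℕ → ℕ
maxL = foldr _⊔_ 0

minL : List ℕ → ℕ
minL []       = 0
minL (x ∷ xs) = foldr _⊓_ x xs

-- Cycle rank of G[S], with fuel (fuel ≥ |S| + 1 suffices, each recursive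
-- call is on a strictly smaller vertex set):
--   0                               if G[S] is acyclic,
--   1 + min_{v ∈ S} cr(G[S] - v)     if G[S] strongly connected with an edge,
--   max over the SCCs C of cr(G[C])  otherwise.
crF : ∀ {n} → Digraph n → ℕ → VSet n → ℕ
crF G zero S = 0
crF G (suc f) S =
  if acyclic G S then 0
  else if stronglyConnected G S ∧ hasEdge G S
    then suc (minL (map (λ v → crF G f (remove S v)) (elems S)))
    else maxL (map (λ v → crF G f (scc G S v)) (elems S))

full : ∀ {n} → VSet n
full _ = true

cr : ∀ {n} → Digraph n → ℕ
cr {n} G = crF G (suc n) full

-- A linear ordering L of V(G) = Fin n, given by the position map L : Fin n ↔ Fin n;
-- w ≤_L u  iff  position of w ≤ position of u.
LinOrder : ℕ → Set
LinOrder n = Permutation′ n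

_≤L?_within_ : ∀ {n} → Fin n → Fin n → LinOrder n → Bool
w ≤L? u within L = toℕ (L ⟨$⟩ʳ w) ≤ᵇ toℕ (L ⟨$⟩ʳ u)

above : ∀ {n} → LinOrder n → Fin n → VSet n
above L w u = w ≤L? u within L

inWReach : ∀ {n} → Digraph n → LinOrder n → Fin n → Fin n → Bool
inWReach G L v w = (w ≤L? v within L) ∧ reach G (above L w) v w

wreachSize : ∀ {n} → Digraph n → LinOrder n → Fin n → ℕ
wreachSize {n} G L v = length (filter (λ w → inWReach G L v w Data.Bool.≟ true) (allFin n))

wcolOf : ∀ {n} → Digraph n → LinOrder n → ℕ
wcolOf {n} G L = maxL (map (wreachSize G L) (allFin n))

IsWcol : ∀ {n} → Digraph n → ℕ → Set
IsWcol {n} G m =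
  Σ (LinOrder n) (λ L → wcolOf G L ≡ m) × ((L : LinOrder n) → m ≤ wcolOf G L)

-- Both inequalities are proved by induction along the recursion defining cr, with linear orders
-- generalised to rank functions r : V → ℕ (ties allowed) and WReach taken with respect to r.
--
-- cr ≤ wcol − 1.  If G[S] is strongly connected with an edge, the r-minimal vertex m of S is
-- weakly reachable from every vertex of S, so deleting m makes every weak reach set smaller by one;
-- looplessness keeps G[S] − m nonempty, so these sets have at least two elements.  Passing to a
-- strongly connected component only shrinks weak reach sets.
--
-- wcol ≤ cr + 1.  If G[S] is strongly connected with an edge, rank an optimal vertex m below an
-- optimal ranking of G[S] − m; m then adds at most one vertex to each weak reach set.  Otherwise
-- rank every vertex first by its number of ancestors and then by the ranking of its component:
-- a weak reach path from v to w stays inside the component of v, since v reaches w although w has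
-- no more ancestors than v.  Breaking ties by vertex index turns a ranking into a linear order and
-- can only shrink weak reach sets.

module Submission where

open import Defs
open import Data.Nat
  using (ℕ; zero; suc; _+_; _*_; _∸_; _≤_; _<_; _≤?_; _≤ᵇ_; _<ᵇ_; _⊓_; pred; z≤n; s≤s; s≤s⁻¹; >-nonZero)
open import Data.Nat.Properties
  using (≤-refl; ≤-reflexive; ≤-trans; ≤-antisym; <-irrefl; <-trans; <-≤-trans; <⇒≱; ≰⇒>; 1+n≰n;
         module ≤-Reasoning; ≤ᵇ⇒≤; ≤⇒≤ᵇ; <ᵇ⇒<; <⇒<ᵇ; +-comm; +-suc; m≤m+n; m≤n+m;
         +-mono-≤; +-mono-<-≤; +-mono-≤-<; +-monoʳ-<; +-cancelˡ-≤; +-cancelˡ-≡; *-monoˡ-≤;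
         m≤m⊔n; m≤n⊔m; ⊔-lub; m⊓n≤m; m⊓n≤n; ⊓-sel; pred-mono-≤; m≤pred[n]⇒suc[m]≤n)
open import Data.Bool using (Bool; true; false; _∧_; T; if_then_else_)
import Data.Bool as Bool
open import Data.Bool.Properties using (T-∧; T-∨; T-≡)
open import Data.Bool.ListAction using (any; all)
open import Data.Fin using (Fin; toℕ; _≟_; fromℕ<; punchOut)
import Data.Fin as Fin
open import Data.Fin.Properties
  using (suc-injective; toℕ-injective; toℕ-fromℕ<; toℕ<n; punchOut-injective; injective⇒≤; any?)
open import Data.Fin.Permutation using (permutation; _⟨$⟩ʳ_)
import Data.Fin.Permutation as Perm
open import Data.List using ([]; _∷_; map; filter; foldr; length; allFin; tabulate)
open import Data.List.Membership.Propositional using (_∈_; find; lose)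
open import Data.List.Membership.Propositional.Properties using (∈-allFin; ∈-filter⁺; ∈-filter⁻)
open import Data.List.Relation.Unary.Any using (here; there)
open import Data.List.Relation.Unary.Any.Properties using (any⁺; any⁻)
import Data.List.Relation.Unary.All as All
open import Data.List.Relation.Unary.All.Properties using (all⁺; all⁻; ¬All⇒Any¬)
open import Data.Maybe using (Maybe; just; nothing; fromMaybe)
import Data.Maybe as Maybe
open import Data.Product using (Σ; ∃; ∃₂; _×_; _,_; proj₁; proj₂)
open import Data.Sum using (_⊎_; inj₁; inj₂)
open import Data.Empty using (⊥-elim)
open import Function using (_∘_; id)
open import Function.Definitions using (Injective)
open import Function.Bundles using (Equivalence)
open import Relation.Nullary using (¬_; Dec; yes; no; does; contradiction)
open import Relation.Nullary.Decidable
  using (T?; toWitness; fromWitness; toWitnessFalse; fromWitnessFalse; dec-true; dec-false; decidable-stable)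
open import Relation.Binary.PropositionalEquality
  using (_≡_; _≢_; refl; sym; trans; cong; subst; subst₂; module ≡-Reasoning)

T-∧⁻ : ∀ {a b} → T (a ∧ b) → T a × T b
T-∧⁻ = Equivalence.to T-∧

T-∧⁺ : ∀ {a b} → T a → T b → T (a ∧ b)
T-∧⁺ p q = Equivalence.from T-∧ (p , q)

infix 4 _⊆_
_⊆_ : ∀ {n} → VSet n → VSet n → Set
P ⊆ Q = ∀ x → T (P x) → T (Q x)

∈-elems⁺ : ∀ {n} {S : VSet n} {x} → T (S x) → x ∈ elems S
∈-elems⁺ {x = x} Sx = ∈-filter⁺ _ (∈-allFin x) (Equivalence.to T-≡ Sx)

∈-elems⁻ : ∀ {n} {S : VSet n} {x} → x ∈ elems S → T (S x)
∈-elems⁻ {n} {S} x∈S = Equivalence.from T-≡ (proj₂ (∈-filter⁻ (λ v → S v Bool.≟ true) {xs = allFin n} x∈S))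

any-elems⁺ : ∀ {n} (S : VSet n) (p : Fin n → Bool) {x} → T (S x) → T (p x) → T (any p (elems S))
any-elems⁺ S p Sx px = any⁺ p (lose (∈-elems⁺ Sx) px)

any-elems⁻ : ∀ {n} (S : VSet n) (p : Fin n → Bool) → T (any p (elems S)) → ∃ λ x → T (S x) × T (p x)
any-elems⁻ S p h with find (any⁻ p (elems S) h)
... | x , x∈S , px = x , ∈-elems⁻ x∈S , px

all-elems⁻ : ∀ {n} (S : VSet n) (p : Fin n → Bool) → T (all p (elems S)) → ∀ {x} → T (S x) → T (p x)
all-elems⁻ S p h Sx = All.lookup (all⁺ p (elems S) h) (∈-elems⁺ Sx)

¬all-elems⁻ : ∀ {n} (S : VSet n) (p : Fin n → Bool) → ¬ T (all p (elems S)) → ∃ λ x → T (S x) × ¬ T (p x)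
¬all-elems⁻ S p h with find (¬All⇒Any¬ (T? ∘ p) (elems S) (h ∘ all⁻ p))
... | x , x∈S , ¬px = x , ∈-elems⁻ x∈S , ¬px

maxL-ub : ∀ {A : Set} (g : A → ℕ) {xs x} → x ∈ xs → g x ≤ maxL (map g xs)
maxL-ub g (here refl) = m≤m⊔n _ _
maxL-ub g {y ∷ _} (there x∈xs) = ≤-trans (maxL-ub g x∈xs) (m≤n⊔m (g y) _)

maxL-lub : ∀ {A : Set} (g : A → ℕ) xs {b} → (∀ {x} → x ∈ xs → g x ≤ b) → maxL (map g xs) ≤ b
maxL-lub g []       h = z≤n
maxL-lub g (x ∷ xs) h = ⊔-lub (h (here refl)) (maxL-lub g xs (h ∘ there))

foldr-⊓-lb : ∀ {A : Set} (g : A → ℕ) s {xs x} → x ∈ xs → foldr _⊓_ s (map g xs) ≤ g x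
foldr-⊓-lb g s (here refl) = m⊓n≤m _ _
foldr-⊓-lb g s {y ∷ _} (there x∈xs) = ≤-trans (m⊓n≤n (g y) _) (foldr-⊓-lb g s x∈xs)

foldr-⊓-≤-seed : ∀ {A : Set} (g : A → ℕ) s xs → foldr _⊓_ s (map g xs) ≤ s
foldr-⊓-≤-seed g s []       = ≤-refl
foldr-⊓-≤-seed g s (y ∷ xs) = ≤-trans (m⊓n≤n (g y) _) (foldr-⊓-≤-seed g s xs)

foldr-⊓-sel : ∀ {A : Set} (g : A → ℕ) s xs →
  foldr _⊓_ s (map g xs) ≡ s ⊎ ∃ λ x → x ∈ xs × foldr _⊓_ s (map g xs) ≡ g x
foldr-⊓-sel g s []       = inj₁ refl
foldr-⊓-sel g s (y ∷ xs) with ⊓-sel (g y) (foldr _⊓_ s (map g xs)) | foldr-⊓-sel g s xs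
... | inj₁ e | _                  = inj₂ (y , here refl , e)
... | inj₂ e | inj₁ e′            = inj₁ (trans e e′)
... | inj₂ e | inj₂ (x , x∈ , e′) = inj₂ (x , there x∈ , trans e e′)

minL-lb : ∀ {A : Set} (g : A → ℕ) {xs x} → x ∈ xs → minL (map g xs) ≤ g x
minL-lb g {y ∷ xs} (here refl)  = foldr-⊓-≤-seed g (g y) xs
minL-lb g {y ∷ xs} (there x∈xs) = foldr-⊓-lb g (g y) x∈xs

minL-argmin : ∀ {A : Set} (g : A → ℕ) {xs x} → x ∈ xs → ∃ λ m → m ∈ xs × minL (map g xs) ≡ g m
minL-argmin g {y ∷ xs} _ with foldr-⊓-sel g (g y) xs
... | inj₁ e            = y , here refl , e
... | inj₂ (m , m∈ , e) = m , there m∈ , e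

bit : Bool → ℕ
bit false = 0
bit true  = 1

count : ∀ {n} → VSet n → ℕ
count {zero}  P = 0
count {suc n} P = bit (P Fin.zero) + count (P ∘ Fin.suc)

bit≤1 : ∀ a → bit a ≤ 1
bit≤1 false = z≤n
bit≤1 true  = ≤-refl

bit-mono : ∀ {a b} → (T a → T b) → bit a ≤ bit b
bit-mono {false}         _ = z≤n
bit-mono {true} {true}   _ = ≤-refl
bit-mono {true} {false}  h = ⊥-elim (h _)

bit-strict : ∀ {a b} → ¬ T a → T b → bit a < bit b
bit-strict {false} {true} _  _ = s≤s z≤n
bit-strict {true}         ¬a _ = contradiction _ ¬a

count-mono : ∀ {n} {P Q : VSet n} → P ⊆ Q → count P ≤ count Q
count-mono {zero}  _   = z≤n
count-mono {suc n} P⊆Q = +-mono-≤ (bit-mono (P⊆Q Fin.zero)) (count-mono (P⊆Q ∘ Fin.suc))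

count-strict : ∀ {n} {P Q : VSet n} {x} → P ⊆ Q → T (Q x) → ¬ T (P x) → count P < count Q
count-strict {x = Fin.zero}  P⊆Q Qx ¬Px = +-mono-<-≤ (bit-strict ¬Px Qx) (count-mono (P⊆Q ∘ Fin.suc))
count-strict {x = Fin.suc x} P⊆Q Qx ¬Px =
  +-mono-≤-< (bit-mono (P⊆Q Fin.zero)) (count-strict (P⊆Q ∘ Fin.suc) Qx ¬Px)

count-pos : ∀ {n} {P : VSet n} {x} → T (P x) → 0 < count P
count-pos {x = Fin.zero}  Px = +-mono-<-≤ (bit-strict id Px) z≤n
count-pos {P = P} {Fin.suc x} Px = +-mono-≤-< z≤n (count-pos {P = P ∘ Fin.suc} Px)

count≤n : ∀ {n} (P : VSet n) → count P ≤ n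
count≤n {zero}  P = z≤n
count≤n {suc n} P = +-mono-≤ (bit≤1 (P Fin.zero)) (count≤n (P ∘ Fin.suc))

count-≤-suc : ∀ {n} {P Q : VSet n} x → (∀ w → w ≢ x → T (P w) → T (Q w)) → count P ≤ suc (count Q)
count-≤-suc {suc n} {P} {Q} Fin.zero h = begin
  bit (P Fin.zero) + count (P ∘ Fin.suc) ≤⟨ +-mono-≤ (bit≤1 (P Fin.zero)) (count-mono λ w → h (Fin.suc w) λ ()) ⟩
  suc (count (Q ∘ Fin.suc))              ≤⟨ s≤s (m≤n+m _ (bit (Q Fin.zero))) ⟩
  suc (count Q)                          ∎
  where open ≤-Reasoning
count-≤-suc {suc n} {P} {Q} (Fin.suc x) h = begin
  bit (P Fin.zero) + count (P ∘ Fin.suc)        ≤⟨ +-mono-≤ (bit-mono (h Fin.zero λ ()))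
                                                     (count-≤-suc x λ w w≢x → h (Fin.suc w) (w≢x ∘ suc-injective)) ⟩
  bit (Q Fin.zero) + suc (count (Q ∘ Fin.suc))  ≡⟨ +-suc (bit (Q Fin.zero)) _ ⟩
  suc (count Q)                                 ∎
  where open ≤-Reasoning

count≤1 : ∀ {n} {P : VSet n} x → (∀ w → T (P w) → w ≡ x) → count P ≤ 1
count≤1 {n} x h =
  ≤-trans (count-≤-suc {Q = λ _ → false} x λ w w≢x Pw → w≢x (h w Pw)) (s≤s (≤-reflexive (count-none n)))
  where
  count-none : ∀ n → count {n} (λ _ → false) ≡ 0
  count-none zero    = refl
  count-none (suc n) = count-none n

⊆∧count≤⇒⊇ : ∀ {n} {P Q : VSet n} → P ⊆ Q → count Q ≤ count P → Q ⊆ P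
⊆∧count≤⇒⊇ {P = P} {Q} P⊆Q cQ≤cP x Qx with T? (P x)
... | yes Px = Px
... | no ¬Px = contradiction cQ≤cP (<⇒≱ (count-strict {P = P} {Q} P⊆Q Qx ¬Px))

length-filter≡count : ∀ {n} (P : VSet n) → length (filter (λ w → P w Bool.≟ true) (allFin n)) ≡ count P
length-filter≡count P = length-filter-tabulate {P = P} id
  where
  length-filter-tabulate : ∀ {n m} {P : VSet n} (f : Fin m → Fin n) →
    length (filter (λ w → P w Bool.≟ true) (tabulate f)) ≡ count (P ∘ f)
  length-filter-tabulate {m = zero}      f = refl
  length-filter-tabulate {m = suc m} {P} f with P (f Fin.zero)
  ... | true  = cong suc (length-filter-tabulate (f ∘ Fin.suc))
  ... | false = length-filter-tabulate (f ∘ Fin.suc)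

m*o+p≤n*o+q⇒m≤n : ∀ {m n o p q} → q < o → m * o + p ≤ n * o + q → m ≤ n
m*o+p≤n*o+q⇒m≤n {m} {n} {o} {p} {q} q<o h with m ≤? n
... | yes m≤n = m≤n
... | no  m≰n = contradiction h (<⇒≱ (begin-strict
  n * o + q  <⟨ +-monoʳ-< (n * o) q<o ⟩
  n * o + o  ≡⟨ +-comm (n * o) o ⟩
  suc n * o  ≤⟨ *-monoˡ-≤ o (≰⇒> m≰n) ⟩
  m * o      ≤⟨ m≤m+n (m * o) p ⟩
  m * o + p  ∎))
  where open ≤-Reasoning

injective⇒surjective : ∀ {m} {f : Fin m → Fin m} → Injective _≡_ _≡_ f → ∀ y → ∃ λ x → f x ≡ y
injective⇒surjective {suc m} {f} f-injective y with any? (λ x → f x ≟ y)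
... | yes hit  = hit
... | no  miss = contradiction (injective⇒≤ g-injective) 1+n≰n
  where
  g : Fin (suc m) → Fin m
  g x = punchOut {i = y} {j = f x} λ y≡fx → miss (x , sym y≡fx)
  g-injective : Injective _≡_ _≡_ g
  g-injective {a} {b} =
    f-injective ∘ punchOut-injective {i = y} (λ y≡fa → miss (a , sym y≡fa)) (λ y≡fb → miss (b , sym y≡fb))

∃minimal : ∀ {n} (r : Fin n → ℕ) {S : VSet n} {x} → T (S x) → ∃ λ m → T (S m) × (∀ {u} → T (S u) → r m ≤ r u)
∃minimal r {S} Sx with minL-argmin r (∈-elems⁺ {S = S} Sx)
... | m , m∈S , min≡rm = m , ∈-elems⁻ m∈S , λ Su → subst (_≤ _) min≡rm (minL-lb r (∈-elems⁺ Su))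

remove⊆ : ∀ {n} {S : VSet n} {m} → remove S m ⊆ S
remove⊆ {S = S} u = proj₁ ∘ T-∧⁻ {S u}

remove-∉ : ∀ {n} {S : VSet n} m → ¬ T (remove S m m)
remove-∉ {S = S} m h = toWitnessFalse (proj₂ (T-∧⁻ {S m} h)) refl

remove⁺ : ∀ {n} {S : VSet n} {m u} → T (S u) → u ≢ m → T (remove S m u)
remove⁺ Su u≢m = T-∧⁺ Su (fromWitnessFalse u≢m)

remove-smaller : ∀ {n} {S : VSet n} {m} → T (S m) → count (remove S m) < count S
remove-smaller {S = S} {m} Sm = count-strict (remove⊆ {S = S} {m}) Sm (remove-∉ {S = S} m)

firstTrue : ∀ {n} → VSet n → Maybe (Fin n)
firstTrue {zero}  P = nothing
firstTrue {suc n} P = if P Fin.zero then just Fin.zero else Maybe.map Fin.suc (firstTrue (P ∘ Fin.suc))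

firstTrue-sound : ∀ {n} {P : VSet n} {y} → firstTrue P ≡ just y → T (P y)
firstTrue-sound {suc n} {P} e with P Fin.zero in Pzero
firstTrue-sound {suc n} {P} refl | true = Equivalence.from T-≡ Pzero
firstTrue-sound {suc n} {P} e    | false with firstTrue (P ∘ Fin.suc) in e′
firstTrue-sound {suc n} {P} refl | false | just y = firstTrue-sound {P = P ∘ Fin.suc} e′

firstTrue-complete : ∀ {n} {P : VSet n} {x} → T (P x) → ∃ λ y → firstTrue P ≡ just y
firstTrue-complete {suc n} {P} {x} Px with P Fin.zero in Pzero | x
... | true  | _          = Fin.zero , refl
... | false | Fin.zero   = contradiction (trans (sym (Equivalence.to T-≡ Px)) Pzero) λ ()
... | false | Fin.suc x′ with firstTrue-complete {P = P ∘ Fin.suc} Px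
...   | y , e = Fin.suc y , cong (Maybe.map Fin.suc) e

firstTrue-cong : ∀ {n} {P Q : VSet n} → P ⊆ Q → Q ⊆ P → firstTrue P ≡ firstTrue Q
firstTrue-cong {zero}          _   _   = refl
firstTrue-cong {suc n} {P} {Q} P⊆Q Q⊆P with P Fin.zero | Q Fin.zero | P⊆Q Fin.zero | Q⊆P Fin.zero
... | true  | true  | _ | _ = refl
... | true  | false | h | _ = ⊥-elim (h _)
... | false | true  | _ | h = ⊥-elim (h _)
... | false | false | _ | _ = cong (Maybe.map Fin.suc) (firstTrue-cong (P⊆Q ∘ Fin.suc) (Q⊆P ∘ Fin.suc))

module Reachability {n : ℕ} (G : Digraph n) where

  data Path (S : VSet n) (u : Fin n) : Fin n → Set where
    nil  : T (S u) → Path S u u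
    snoc : ∀ {x y} → Path S u x → T (E G x y) → T (S y) → Path S u y

  module _ {S : VSet n} where

    Path-source : ∀ {u v} → Path S u v → T (S u)
    Path-source (nil Su)       = Su
    Path-source (snoc p _ _)   = Path-source p

    Path-target : ∀ {u v} → Path S u v → T (S v)
    Path-target (nil Sv)       = Sv
    Path-target (snoc _ _ Sv)  = Sv

    infixr 5 _++ₚ_
    _++ₚ_ : ∀ {u v w} → Path S u v → Path S v w → Path S u w
    p ++ₚ nil _        = p
    p ++ₚ snoc q e Sy  = snoc (p ++ₚ q) e Sy

    reachK-extend : ∀ k {u x y} → T (reachK G S k u x) → T (E G x y) → T (S y) → T (reachK G S (suc k) u y)
    reachK-extend k {u} {x} {y} ux e Sy =
      Equivalence.from T-∨ (inj₂ (any⁺ (λ w → reachK G S k u w ∧ E G w y ∧ S y)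
                                       (lose (∈-allFin x) (T-∧⁺ ux (T-∧⁺ e Sy)))))

    reachK-suc⁻ : ∀ k {u v} → T (reachK G S (suc k) u v) →
      T (reachK G S k u v) ⊎ ∃ λ w → T (reachK G S k u w) × T (E G w v) × T (S v)
    reachK-suc⁻ k {u} {v} h with Equivalence.to T-∨ h
    ... | inj₁ old = inj₁ old
    ... | inj₂ new with find (any⁻ (λ w → reachK G S k u w ∧ E G w v ∧ S v) (allFin n) new)
    ...   | w , _ , uw∧wv with T-∧⁻ {reachK G S k u w} uw∧wv
    ...     | uw , wv = inj₂ (w , uw , T-∧⁻ wv)

    reachK⇒Path : ∀ k {u v} → T (reachK G S k u v) → Path S u v
    reachK⇒Path zero {u} h with T-∧⁻ {S u} h
    ... | Su , u≡v with refl ← toWitness u≡v = nil Su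
    reachK⇒Path (suc k) h with reachK-suc⁻ k h
    ... | inj₁ old                 = reachK⇒Path k old
    ... | inj₂ (_ , uw , e , Sv)   = snoc (reachK⇒Path k uw) e Sv

    Path⇒reachK : ∀ {u v} → Path S u v → ∃ λ k → T (reachK G S k u v)
    Path⇒reachK (nil Su) = zero , T-∧⁺ Su (fromWitness refl)
    Path⇒reachK (snoc p e Sy) with Path⇒reachK p
    ... | k , ux = suc k , reachK-extend k ux e Sy

    -- reach G S u = reachK G S n u.  The sets reachK G S k u grow strictly until they stop
    -- growing for good, and they cannot grow strictly n + 1 times.
    module Saturation (u : Fin n) where

      R : ℕ → VSet n
      R k = reachK G S k u

      R-step : ∀ k → R k ⊆ R (suc k)
      R-step k _ Rk = Equivalence.from T-∨ (inj₁ Rk)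

      R₀⊆R : ∀ k → R 0 ⊆ R k
      R₀⊆R zero    _ = id
      R₀⊆R (suc k) x = R-step k x ∘ R₀⊆R k x

      R-suc-mono : ∀ j k → R j ⊆ R k → R (suc j) ⊆ R (suc k)
      R-suc-mono j k Rj⊆Rk x h with reachK-suc⁻ j h
      ... | inj₁ old                = R-step k x (Rj⊆Rk x old)
      ... | inj₂ (_ , uw , e , Sv)  = reachK-extend k (Rj⊆Rk _ uw) e Sv
      R-closed : ∀ k → R (suc k) ⊆ R k → ∀ j → R j ⊆ R k
      R-closed k _      zero    = R₀⊆R k
      R-closed k closed (suc j) x = closed x ∘ R-suc-mono j k (R-closed k closed j) x

      R-grows-or-closes : T (S u) → ∀ k → suc k ≤ count (R k) ⊎ (∀ j → R j ⊆ R k)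
      R-grows-or-closes Su zero = inj₁ (count-pos {P = R 0} (T-∧⁺ Su (fromWitness refl)))
      R-grows-or-closes Su (suc k) with R-grows-or-closes Su k
      ... | inj₂ closed = inj₂ λ j x → R-step k x ∘ closed j x
      ... | inj₁ grown with count (R (suc k)) ≤? count (R k)
      ...   | yes ≤old = inj₂ λ j x → R-step k x ∘ R-closed k (⊆∧count≤⇒⊇ (R-step k) ≤old) j x
      ...   | no  >old = inj₁ (≤-trans (s≤s grown) (≰⇒> >old))

      R-saturated : T (S u) → ∀ j → R j ⊆ R n
      R-saturated Su with R-grows-or-closes Su n
      ... | inj₂ closed = closed
      ... | inj₁ grown  = contradiction (count≤n (R n)) (<⇒≱ grown)

    reach⇒Path : ∀ {u v} → T (reach G S u v) → Path S u v
    reach⇒Path = reachK⇒Path n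

    Path⇒reach : ∀ {u v} → Path S u v → T (reach G S u v)
    Path⇒reach p with Path⇒reachK p
    ... | k , h = Saturation.R-saturated _ (Path-source p) k _ h

    reach-refl : ∀ {u} → T (S u) → T (reach G S u u)
    reach-refl = Path⇒reach ∘ nil

    reach-trans : ∀ {u v w} → T (reach G S u v) → T (reach G S v w) → T (reach G S u w)
    reach-trans uv vw = Path⇒reach (reach⇒Path uv ++ₚ reach⇒Path vw)

    reach-source : ∀ {u v} → T (reach G S u v) → T (S u)
    reach-source = Path-source ∘ reach⇒Path

    reach-target : ∀ {u v} → T (reach G S u v) → T (S v)
    reach-target = Path-target ∘ reach⇒Path

    Path-trim : ∀ {v w} → Path S v w → Path (λ u → S u ∧ reach G S v u ∧ reach G S u w) v w
    Path-trim p = go p (reach-refl (Path-target p))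
      where
      go : ∀ {v x w} → Path S v x → T (reach G S x w) → Path (λ u → S u ∧ reach G S v u ∧ reach G S u w) v x
      go (nil Sv)          vw = nil (T-∧⁺ Sv (T-∧⁺ (reach-refl Sv) vw))
      go (snoc p e Sy) yw = snoc (go p (reach-trans (Path⇒reach (snoc (nil (Path-target p)) e Sy)) yw)) e
                                 (T-∧⁺ Sy (T-∧⁺ (Path⇒reach (snoc p e Sy)) yw))

  Path-mono : ∀ {S S′ u v} → S ⊆ S′ → Path S u v → Path S′ u v
  Path-mono S⊆S′ (nil Su)       = nil (S⊆S′ _ Su)
  Path-mono S⊆S′ (snoc p e Sy)  = snoc (Path-mono S⊆S′ p) e (S⊆S′ _ Sy)

  reach-mono : ∀ {S S′ u v} → S ⊆ S′ → T (reach G S u v) → T (reach G S′ u v)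
  reach-mono S⊆S′ = Path⇒reach ∘ Path-mono S⊆S′ ∘ reach⇒Path

  mutual-reach⇒hasCycle : ∀ {S v w} → w ≢ v → T (reach G S v w) → T (reach G S w v) → T (hasCycle G S)
  mutual-reach⇒hasCycle {S} {v} {w} w≢v vw wv with reach⇒Path vw
  ... | nil _ = contradiction refl w≢v
  ... | snoc {x} p e Sw =
    any-elems⁺ S (λ u → any (λ y → E G u y ∧ reach G S y u) (elems S)) (Path-target p)
      (any-elems⁺ S (λ y → E G x y ∧ reach G S y x) Sw (T-∧⁺ e (reach-trans wv (Path⇒reach p))))

  hasEdge⁻ : ∀ {S} → T (hasEdge G S) → ∃₂ λ x y → T (S x) × T (S y) × T (E G x y)
  hasEdge⁻ {S} h with any-elems⁻ S (λ u → any (E G u) (elems S)) h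
  ... | x , Sx , h′ with any-elems⁻ S (E G x) h′
  ...   | y , Sy , e = x , y , Sx , Sy , e

  hasCycle⇒hasEdge : ∀ {S} → T (hasCycle G S) → T (hasEdge G S)
  hasCycle⇒hasEdge {S} h with any-elems⁻ S (λ u → any (λ y → E G u y ∧ reach G S y u) (elems S)) h
  ... | x , Sx , h′ with any-elems⁻ S (λ y → E G x y ∧ reach G S y x) h′
  ...   | y , Sy , e∧r = any-elems⁺ S (λ u → any (E G u) (elems S)) Sx (any-elems⁺ S (E G x) Sy (proj₁ (T-∧⁻ e∧r)))

  stronglyConnected⇒reach : ∀ {S a b} → T (stronglyConnected G S) → T (S a) → T (S b) → T (reach G S a b)
  stronglyConnected⇒reach {S} {a} sc Sa Sb =
    all-elems⁻ S (reach G S a) (all-elems⁻ S (λ u → all (reach G S u) (elems S)) sc Sa) Sb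

  ¬stronglyConnected⇒unreachable : ∀ {S} → ¬ T (stronglyConnected G S) →
    ∃₂ λ a b → T (S a) × T (S b) × ¬ T (reach G S a b)
  ¬stronglyConnected⇒unreachable {S} ¬sc with ¬all-elems⁻ S (λ u → all (reach G S u) (elems S)) ¬sc
  ... | a , Sa , ¬a→all with ¬all-elems⁻ S (reach G S a) ¬a→all
  ...   | b , Sb , ¬ab = a , b , Sa , Sb , ¬ab

  module _ {S : VSet n} where

    scc⁺ : ∀ {v u} → T (reach G S v u) → T (reach G S u v) → T (scc G S v u)
    scc⁺ vu uv = T-∧⁺ (reach-target vu) (T-∧⁺ vu uv)

    scc⁻ : ∀ {v u} → T (scc G S v u) → T (reach G S v u) × T (reach G S u v)
    scc⁻ {u = u} h = T-∧⁻ (proj₂ (T-∧⁻ {S u} h))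

    scc⊆ : ∀ {v} → scc G S v ⊆ S
    scc⊆ u = proj₁ ∘ T-∧⁻ {S u}

    scc-self : ∀ {v} → T (S v) → T (scc G S v v)
    scc-self Sv = scc⁺ (reach-refl Sv) (reach-refl Sv)

    scc-sym : ∀ {v u} → T (scc G S v u) → T (scc G S u v)
    scc-sym h = let vu , uv = scc⁻ h in scc⁺ uv vu

    scc-⊆ : ∀ {v u} → T (scc G S v u) → scc G S u ⊆ scc G S v
    scc-⊆ h _ h′ = let vu , uv = scc⁻ h ; uz , zu = scc⁻ h′ in scc⁺ (reach-trans vu uz) (reach-trans zu uv)

    rep : Fin n → Fin n
    rep u = fromMaybe u (firstTrue (scc G S u))

    rep-∈-scc : ∀ {u} → T (S u) → T (scc G S u (rep u))
    rep-∈-scc {u} Su with firstTrue (scc G S u) in e | firstTrue-complete {P = scc G S u} (scc-self Su)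
    ... | just y | _ = firstTrue-sound e

    rep-cong : ∀ {v u} → T (scc G S v u) → rep u ≡ rep v
    rep-cong {v} {u} h with firstTrue-complete {P = scc G S v} (scc-self (reach-source (proj₁ (scc⁻ h))))
    ... | y , v↦y = trans (cong (fromMaybe u) (trans u↦v v↦y)) (sym (cong (fromMaybe v) v↦y))
      where
      u↦v : firstTrue (scc G S u) ≡ firstTrue (scc G S v)
      u↦v = firstTrue-cong {P = scc G S u} {scc G S v} (scc-⊆ h) (scc-⊆ (scc-sym h))

  scc-proper : ∀ {S a b} → T (S a) → T (S b) → ¬ T (reach G S a b) → ∀ c → count (scc G S c) < count S
  scc-proper {S} {a} {b} Sa Sb ¬ab c with T? (scc G S c a) | T? (scc G S c b)
  ... | no  a∉ | _      = count-strict (scc⊆ {S = S} {c}) Sa a∉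
  ... | yes _  | no b∉  = count-strict (scc⊆ {S = S} {c}) Sb b∉
  ... | yes a∈ | yes b∈ = contradiction (reach-trans (proj₂ (scc⁻ a∈)) (proj₁ (scc⁻ b∈))) ¬ab

module WeakReachability {n : ℕ} (G : Digraph n) where

  open Reachability G

  upset : (Fin n → ℕ) → VSet n → Fin n → VSet n
  upset r S w u = S u ∧ (r w ≤ᵇ r u)

  wreach : (Fin n → ℕ) → VSet n → Fin n → VSet n
  wreach r S v w = (r w ≤ᵇ r v) ∧ reach G (upset r S w) v w

  module _ {r : Fin n → ℕ} {S : VSet n} where

    upset⁺ : ∀ {w u} → T (S u) → r w ≤ r u → T (upset r S w u)
    upset⁺ Su rw≤ru = T-∧⁺ Su (≤⇒≤ᵇ rw≤ru)

    upset⁻ : ∀ {w u} → T (upset r S w u) → T (S u) × r w ≤ r u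
    upset⁻ {w} {u} h with T-∧⁻ {S u} h
    ... | Su , rw≤ru = Su , ≤ᵇ⇒≤ _ _ rw≤ru

    upset⊆ : ∀ {w} → upset r S w ⊆ S
    upset⊆ _ = proj₁ ∘ upset⁻

    wreach⁺ : ∀ {v w} → r w ≤ r v → T (reach G (upset r S w) v w) → T (wreach r S v w)
    wreach⁺ rw≤rv = T-∧⁺ (≤⇒≤ᵇ rw≤rv)

    wreach⁻ : ∀ {v w} → T (wreach r S v w) → r w ≤ r v × T (reach G (upset r S w) v w)
    wreach⁻ {v} {w} h with T-∧⁻ {r w ≤ᵇ r v} h
    ... | rw≤rv , vw = ≤ᵇ⇒≤ _ _ rw≤rv , vw

    wreach-self : ∀ {v} → T (S v) → T (wreach r S v v)
    wreach-self Sv = wreach⁺ ≤-refl (reach-refl (upset⁺ Sv ≤-refl))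

    wreach-source : ∀ {v w} → T (wreach r S v w) → T (S v)
    wreach-source = upset⊆ _ ∘ reach-source ∘ proj₂ ∘ wreach⁻

    wreach-target : ∀ {v w} → T (wreach r S v w) → T (S w)
    wreach-target = upset⊆ _ ∘ reach-target ∘ proj₂ ∘ wreach⁻

  wreach-mono : ∀ {r r′ S S′ v} → S ⊆ S′ → (∀ {w u} → T (S w) → T (S u) → r w ≤ r u → r′ w ≤ r′ u) →
    wreach r S v ⊆ wreach r′ S′ v
  wreach-mono {r} {r′} {S} {S′} S⊆S′ r⇒r′ w h with wreach⁻ h
  ... | rw≤rv , vw = wreach⁺ (r⇒r′ Sw (wreach-source {r} h) rw≤rv) (reach-mono along vw)
    where
    Sw : T (S w)
    Sw = wreach-target {r} h
    along : upset r S w ⊆ upset r′ S′ w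
    along u h′ with upset⁻ {r} {S} h′
    ... | Su , rw≤ru = upset⁺ {r′} {S′} (S⊆S′ u Su) (r⇒r′ Sw Su rw≤ru)

module LowerBound {n : ℕ} (G : Digraph n) (loopless : Loopless G) (r : Fin n → ℕ) where

  open Reachability G
  open WeakReachability G

  wreach-remove-minimal : ∀ {S m v} → T (stronglyConnected G S) → T (S m) → (∀ {u} → T (S u) → r m ≤ r u) →
    T (remove S m v) → count (wreach r (remove S m) v) < count (wreach r S v)
  wreach-remove-minimal {S} {m} {v} sc Sm minimal S′v =
    count-strict {P = wreach r (remove S m) v} {wreach r S v}
      (wreach-mono {r} {r} (remove⊆ {S = S} {m}) λ _ _ → id)
      (wreach⁺ (minimal Sv) (reach-mono (λ u Su → upset⁺ {r} {S} Su (minimal Su)) (stronglyConnected⇒reach sc Sv Sm)))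
      (remove-∉ {S = S} m ∘ wreach-target {r} {remove S m})
    where
    Sv : T (S v)
    Sv = remove⊆ {S = S} {m} v S′v

  remove-nonempty : ∀ {S x y} → T (S x) → T (S y) → T (E G x y) → ∀ m → ∃ λ u → T (remove S m u)
  remove-nonempty {S} {x} {y} Sx Sy e m with x ≟ m | y ≟ m
  ... | no x≢m   | _        = x , remove⁺ {S = S} Sx x≢m
  ... | yes _    | no y≢m   = y , remove⁺ {S = S} Sy y≢m
  ... | yes refl | yes refl = contradiction (subst T (loopless x) e) id

  crF≤pred : ∀ f S {b} → (∀ {v} → T (S v) → count (wreach r S v) ≤ b) → crF G f S ≤ pred b
  crF≤pred zero    S wreach≤b = z≤n
  crF≤pred (suc f) S {b} wreach≤b with acyclic G S | stronglyConnected G S ∧ hasEdge G S in strong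
  ... | true  | _     = z≤n
  ... | false | false = maxL-lub (λ c → crF G f (scc G S c)) (elems S) λ {c} _ →
    crF≤pred f (scc G S c) λ {v} Cv →
      ≤-trans (count-mono (wreach-mono {r} {r} (scc⊆ {S = S} {c}) λ _ _ → id)) (wreach≤b (scc⊆ {S = S} v Cv))
  ... | false | true with T-∧⁻ {stronglyConnected G S} (Equivalence.from T-≡ strong)
  ...   | sc , edge with hasEdge⁻ {S} edge
  ...     | x , y , Sx , Sy , e with ∃minimal r {S} Sx
  ...       | m , Sm , minimal with remove-nonempty {S} Sx Sy e m
  ...         | u , S′u = m≤pred[n]⇒suc[m]≤n {{>-nonZero 0<pred-b}}
                            (≤-trans (minL-lb (λ v → crF G f (remove S v)) (∈-elems⁺ {S = S} Sm)) ih)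
    where
    S′ : VSet n
    S′ = remove S m
    wreach′≤pred-b : ∀ {v} → T (S′ v) → count (wreach r S′ v) ≤ pred b
    wreach′≤pred-b S′v =
      pred-mono-≤ (≤-trans (wreach-remove-minimal sc Sm minimal S′v) (wreach≤b (remove⊆ {S = S} {m} _ S′v)))
    ih : crF G f S′ ≤ pred (pred b)
    ih = crF≤pred f S′ wreach′≤pred-b
    0<pred-b : 0 < pred b
    0<pred-b = <-≤-trans (count-pos {P = wreach r S′ u} (wreach-self {r} {S′} S′u)) (wreach′≤pred-b S′u)

module UpperBound {n : ℕ} (G : Digraph n) where

  open Reachability G
  open WeakReachability G

  Ranking : VSet n → ℕ → Set
  Ranking S k = Σ (Fin n → ℕ) λ r → ∀ {v} → T (S v) → count (wreach r S v) ≤ k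

  Ranking-remove : ∀ {S k} m → Ranking (remove S m) k → Ranking S (suc k)
  Ranking-remove {S} {k} m (ρ , ρ-ok) = r , r-ok
    where
    r : Fin n → ℕ
    r u = if does (u ≟ m) then 0 else suc (ρ u)

    r-m : r m ≡ 0
    r-m = cong (λ b → if b then 0 else suc (ρ m)) (dec-true (m ≟ m) refl)

    r-≢ : ∀ {u} → u ≢ m → r u ≡ suc (ρ u)
    r-≢ {u} u≢m = cong (λ b → if b then 0 else suc (ρ u)) (dec-false (u ≟ m) u≢m)

    above-positive : ∀ {w u} → w ≢ m → r w ≤ r u → u ≢ m × ρ w ≤ ρ u
    above-positive {w} {u} w≢m rw≤ru = u≢m , s≤s⁻¹ (subst₂ _≤_ (r-≢ w≢m) (r-≢ u≢m) rw≤ru)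
      where
      u≢m : u ≢ m
      u≢m refl = contradiction (subst₂ _≤_ (r-≢ w≢m) r-m rw≤ru) λ ()

    wreach-m : ∀ w → T (wreach r S m w) → w ≡ m
    wreach-m w h = decidable-stable (w ≟ m) λ w≢m →
      contradiction (subst₂ _≤_ (r-≢ w≢m) r-m (proj₁ (wreach⁻ h))) λ ()

    wreach-≢m : ∀ {v} w → w ≢ m → T (wreach r S v w) → T (wreach ρ (remove S m) v w)
    wreach-≢m w w≢m h with wreach⁻ h
    ... | rw≤rv , vw = wreach⁺ (proj₂ (above-positive w≢m rw≤rv)) (reach-mono along vw)
      where
      along : upset r S w ⊆ upset ρ (remove S m) w
      along u h′ with upset⁻ {r} {S} h′
      ... | Su , rw≤ru with above-positive w≢m rw≤ru
      ...   | u≢m , ρw≤ρu = upset⁺ {ρ} {remove S m} (remove⁺ {S = S} Su u≢m) ρw≤ρu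

    r-ok : ∀ {v} → T (S v) → count (wreach r S v) ≤ suc k
    r-ok {v} Sv = by-cases (v ≟ m)
      where
      by-cases : Dec (v ≡ m) → count (wreach r S v) ≤ suc k
      by-cases (yes refl) = ≤-trans (count≤1 m wreach-m) (s≤s z≤n)
      by-cases (no v≢m)   = ≤-trans (count-≤-suc m wreach-≢m) (s≤s (ρ-ok (remove⁺ {S = S} Sv v≢m)))

  -- Rank by depth first, then by σ; reach G S u w forces depth u ≤ depth w, and width makes the
  -- sum lexicographic.
  module Condensation (S : VSet n) (σ : Fin n → ℕ) where

    depth : Fin n → ℕ
    depth q = count λ x → reach G S x q

    width : ℕ
    width = suc (maxL (map σ (allFin n)))

    condense : Fin n → ℕ
    condense u = depth u * width + σ u

    depth-mono : ∀ {u w} → T (reach G S u w) → depth u ≤ depth w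
    depth-mono uw = count-mono λ x xu → reach-trans {u = x} xu uw

    depth-≤⇒reach : ∀ {u w} → T (reach G S u w) → depth w ≤ depth u → T (reach G S w u)
    depth-≤⇒reach {w = w} uw dw≤du =
      ⊆∧count≤⇒⊇ (λ x xu → reach-trans {u = x} xu uw) dw≤du w (reach-refl (reach-target uw))

    condense-depth : ∀ {u w} → condense w ≤ condense u → depth w ≤ depth u
    condense-depth {u} = m*o+p≤n*o+q⇒m≤n (s≤s (maxL-ub σ (∈-allFin u)))

    condense-σ : ∀ {u w} → depth u ≡ depth w → condense w ≤ condense u → σ w ≤ σ u
    condense-σ {u} {w} du≡dw h =
      +-cancelˡ-≤ (depth w * width) (σ w) (σ u) (subst (λ d → condense w ≤ d * width + σ u) du≡dw h)

    wreach-condense : ∀ {v w} → T (wreach condense S v w) → T (wreach σ (scc G S v) v w)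
    wreach-condense {v} {w} h with wreach⁻ h
    ... | rw≤rv , p = wreach⁺ (condense-σ (≤-antisym (depth-mono vw) dw≤dv) rw≤rv)
                              (Path⇒reach (Path-mono on-path (Path-trim (reach⇒Path p))))
      where
      X : VSet n
      X = upset condense S w
      vw : T (reach G S v w)
      vw = reach-mono (upset⊆ {condense} {S}) p
      dw≤dv : depth w ≤ depth v
      dw≤dv = condense-depth rw≤rv
      wv : T (reach G S w v)
      wv = depth-≤⇒reach vw dw≤dv
      on-path : (λ u → X u ∧ reach G X v u ∧ reach G X u w) ⊆ upset σ (scc G S v) w
      on-path u h′ with T-∧⁻ {X u} h′
      ... | Xu , vu∧uw with T-∧⁻ {reach G X v u} vu∧uw
      ...   | vu , uw = upset⁺ {σ} {scc G S v} (scc⁺ vu′ (reach-trans uw′ wv))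
                                                (condense-σ du≡dw (proj₂ (upset⁻ {condense} {S} Xu)))
        where
        vu′ : T (reach G S v u)
        vu′ = reach-mono (upset⊆ {condense} {S}) vu
        uw′ : T (reach G S u w)
        uw′ = reach-mono (upset⊆ {condense} {S}) uw
        du≡dw : depth u ≡ depth w
        du≡dw = ≤-antisym (depth-mono uw′) (≤-trans dw≤dv (depth-mono vu′))

  Ranking-acyclic : ∀ {S} → ¬ T (hasCycle G S) → Ranking S 1
  Ranking-acyclic {S} acyclic = condense , λ {v} _ → count≤1 v (wreach-v v)
    where
    open Condensation S (λ _ → 0)
    wreach-v : ∀ v w → T (wreach condense S v w) → w ≡ v
    wreach-v v w h with scc⁻ {S = S} (wreach-target {λ _ → 0} {scc G S v} (wreach-condense h))
    ... | vw , wv = decidable-stable (w ≟ v) λ w≢v → acyclic (mutual-reach⇒hasCycle w≢v vw wv)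

  Ranking-sccs : ∀ {S} (g : Fin n → ℕ) → (∀ c → Ranking (scc G S c) (suc (g c))) →
    Ranking S (suc (maxL (map g (elems S))))
  Ranking-sccs {S} g ranked = condense , ok
    where
    ρ : Fin n → Fin n → ℕ
    ρ c = proj₁ (ranked c)
    σ : Fin n → ℕ
    σ u = ρ (rep {S} u) u
    open Condensation S σ
    ok : ∀ {v} → T (S v) → count (wreach condense S v) ≤ suc (maxL (map g (elems S)))
    ok {v} Sv = begin
      count (wreach condense S v)         ≤⟨ count-mono (λ w → within w ∘ wreach-condense) ⟩
      count (wreach (ρ c) (scc G S c) v)  ≤⟨ proj₂ (ranked c) c~v ⟩
      suc (g c)                           ≤⟨ s≤s (maxL-ub g (∈-elems⁺ (scc⊆ {S = S} c v~c))) ⟩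
      suc (maxL (map g (elems S)))        ∎
      where
      open ≤-Reasoning
      c : Fin n
      c = rep {S} v
      v~c : T (scc G S v c)
      v~c = rep-∈-scc {S = S} Sv
      c~v : T (scc G S c v)
      c~v = scc-sym {S = S} v~c
      within : wreach σ (scc G S v) v ⊆ wreach (ρ c) (scc G S c) v
      within = wreach-mono (scc-⊆ {S = S} c~v) λ {w} {u} v~w v~u →
        subst₂ _≤_ (cong (λ d → ρ d w) (rep-cong {S = S} v~w)) (cong (λ d → ρ d u) (rep-cong {S = S} v~u))

  Ranking-minL : ∀ {S x} (g : Fin n → ℕ) → T (S x) → (∀ {m} → T (S m) → Ranking (remove S m) (suc (g m))) →
    Ranking S (suc (suc (minL (map g (elems S)))))
  Ranking-minL {S} g Sx ranked with minL-argmin g (∈-elems⁺ {S = S} Sx)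
  ... | m , m∈S , min≡gm =
    subst (λ k → Ranking S (suc (suc k))) (sym min≡gm) (Ranking-remove m (ranked (∈-elems⁻ m∈S)))

  crF-ranking : ∀ f S → count S < f → Ranking S (suc (crF G f S))
  crF-ranking zero    S ()
  crF-ranking (suc f) S |S|≤f with hasCycle G S in cyclic | stronglyConnected G S ∧ hasEdge G S in strong
  ... | false | _ = Ranking-acyclic (subst T cyclic)
  ... | true  | true with hasEdge⁻ {S} (proj₂ (T-∧⁻ {stronglyConnected G S} (Equivalence.from T-≡ strong)))
  ...   | _ , _ , Sx , _ , _ = Ranking-minL (λ v → crF G f (remove S v)) Sx λ {m} Sm →
          crF-ranking f (remove S m) (<-≤-trans (remove-smaller {S = S} Sm) (s≤s⁻¹ |S|≤f))
  crF-ranking (suc f) S |S|≤f | true | false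
    with ¬stronglyConnected⇒unreachable {S} (λ sc →
           subst T strong (T-∧⁺ sc (hasCycle⇒hasEdge (Equivalence.from T-≡ cyclic))))
  ... | _ , _ , Sa , Sb , ¬ab = Ranking-sccs (λ c → crF G f (scc G S c)) λ c →
          crF-ranking f (scc G S c) (<-≤-trans (scc-proper Sa Sb ¬ab c) (s≤s⁻¹ |S|≤f))

module RankOrder {n : ℕ} (r : Fin n → ℕ) where

  key : Fin n → ℕ
  key v = r v * n + toℕ v

  key-≤⇒r-≤ : ∀ {u v} → key u ≤ key v → r u ≤ r v
  key-≤⇒r-≤ {v = v} = m*o+p≤n*o+q⇒m≤n (toℕ<n v)

  key-injective : Injective _≡_ _≡_ key
  key-injective {u} {v} e = toℕ-injective (+-cancelˡ-≡ (r u * n) (toℕ u) (toℕ v) (begin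
    r u * n + toℕ u  ≡⟨ e ⟩
    r v * n + toℕ v  ≡⟨ cong (λ k → k * n + toℕ v) (sym ru≡rv) ⟩
    r u * n + toℕ v  ∎))
    where
    open ≡-Reasoning
    ru≡rv : r u ≡ r v
    ru≡rv = ≤-antisym (key-≤⇒r-≤ (≤-reflexive e)) (key-≤⇒r-≤ (≤-reflexive (sym e)))

  key-irrefl : ∀ v → ¬ T (key v <ᵇ key v)
  key-irrefl v = <-irrefl refl ∘ <ᵇ⇒< (key v) (key v)

  position : Fin n → ℕ
  position v = count λ u → key u <ᵇ key v

  position<n : ∀ v → position v < n
  position<n v = <-≤-trans (count-strict {P = λ u → key u <ᵇ key v} {λ _ → true} (λ _ _ → _) _ (key-irrefl v))
                           (count≤n {n} (λ _ → true))

  position-≤⇒key-≤ : ∀ {u v} → position u ≤ position v → key u ≤ key v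
  position-≤⇒key-≤ {u} {v} pu≤pv with key u ≤? key v
  ... | yes ku≤kv = ku≤kv
  ... | no  ku≰kv = contradiction pu≤pv (<⇒≱ (count-strict below-v⊆below-u (<⇒<ᵇ kv<ku) (key-irrefl v)))
    where
    kv<ku : key v < key u
    kv<ku = ≰⇒> ku≰kv
    below-v⊆below-u : (λ x → key x <ᵇ key v) ⊆ (λ x → key x <ᵇ key u)
    below-v⊆below-u x kx<kv = <⇒<ᵇ (<-trans (<ᵇ⇒< _ _ kx<kv) kv<ku)

  π : Fin n → Fin n
  π v = fromℕ< (position<n v)

  π-≤⇒r-≤ : ∀ {u v} → toℕ (π u) ≤ toℕ (π v) → r u ≤ r v
  π-≤⇒r-≤ = key-≤⇒r-≤ ∘ position-≤⇒key-≤ ∘ subst₂ _≤_ (toℕ-fromℕ< _) (toℕ-fromℕ< _)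

  π-injective : Injective _≡_ _≡_ π
  π-injective {u} {v} e =
    key-injective (≤-antisym (position-≤⇒key-≤ (≤-reflexive pu≡pv)) (position-≤⇒key-≤ (≤-reflexive (sym pu≡pv))))
    where
    pu≡pv : position u ≡ position v
    pu≡pv = trans (sym (toℕ-fromℕ< _)) (trans (cong toℕ e) (toℕ-fromℕ< _))

  linOrder : LinOrder n
  linOrder =
    permutation π (proj₁ ∘ π-surjective) (proj₂ ∘ π-surjective) (λ x → π-injective (proj₂ (π-surjective (π x))))
    where
    π-surjective : ∀ y → ∃ λ x → π x ≡ y
    π-surjective = injective⇒surjective π-injective

module WeakColoring {n : ℕ} (G : Digraph n) where

  open WeakReachability G
  open UpperBound G using (Ranking)

  rankOf : LinOrder n → Fin n → ℕ
  rankOf L u = toℕ (L ⟨$⟩ʳ u)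

  wreach≤wcolOf : ∀ L v → count (wreach (rankOf L) full v) ≤ wcolOf G L
  wreach≤wcolOf L v =
    subst (_≤ wcolOf G L) (length-filter≡count (inWReach G L v)) (maxL-ub (wreachSize G L) (∈-allFin v))

  wcolOf-pos : ∀ L → Fin n → 0 < wcolOf G L
  wcolOf-pos L v =
    <-≤-trans (count-pos {P = wreach (rankOf L) full v} (wreach-self {rankOf L} {full} _)) (wreach≤wcolOf L v)

  cr≤pred-wcolOf : Loopless G → ∀ L → cr G ≤ pred (wcolOf G L)
  cr≤pred-wcolOf loopless L = LowerBound.crF≤pred G loopless (rankOf L) (suc n) full λ {v} _ → wreach≤wcolOf L v

  wcolOf-linOrder≤ : ∀ {k} (R : Ranking full k) → wcolOf G (RankOrder.linOrder (proj₁ R)) ≤ k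
  wcolOf-linOrder≤ {k} (r , r-ok) = maxL-lub (wreachSize G L) (allFin n) λ {v} _ → begin
    wreachSize G L v                  ≡⟨ length-filter≡count (inWReach G L v) ⟩
    count (wreach (rankOf L) full v)  ≤⟨ count-mono (wreach-mono (λ _ → id) λ _ _ → RankOrder.π-≤⇒r-≤ r) ⟩
    count (wreach r full v)           ≤⟨ r-ok _ ⟩
    k                                 ∎
    where
    open ≤-Reasoning
    L : LinOrder n
    L = RankOrder.linOrder r

theorem1p3 : (n : ℕ) (G : Digraph n) → Loopless G →
    Σ ℕ (λ w → IsWcol G w × cr G ≡ w ∸ 1)
theorem1p3 zero    G _        = 0 , ((Perm.id , refl) , λ _ → z≤n) , refl
theorem1p3 (suc n) G loopless =
  wcolOf G L₀ , ((L₀ , refl) , λ L → ≤-trans L₀≤ (suc-cr≤ L)) ,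
  ≤-antisym (cr≤pred-wcolOf loopless L₀) (pred-mono-≤ L₀≤)
  where
  open WeakColoring G
  open UpperBound G using (Ranking; crF-ranking)
  optimal : Ranking full (suc (cr G))
  optimal = crF-ranking (suc (suc n)) full (s≤s (count≤n full))
  L₀ : LinOrder (suc n)
  L₀ = RankOrder.linOrder (proj₁ optimal)
  L₀≤ : wcolOf G L₀ ≤ suc (cr G)
  L₀≤ = wcolOf-linOrder≤ optimal
  suc-cr≤ : ∀ L → suc (cr G) ≤ wcolOf G L
  suc-cr≤ L = m≤pred[n]⇒suc[m]≤n {{>-nonZero (wcolOf-pos L Fin.zero)}} (cr≤pred-wcolOf loopless L)
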